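{- Let $A$ be a real $2\times 2$ matrix, $B$ a real $1\times 2$ row vector, and $\mathrm{NT}=\{\vec{x}\in\mathbb{R}^2 : BA^k\vec{x}>0 \ \forall k\ge 0\}$. Suppose $A$ has a positive eigenvalue $\lambda_1$ and a negative eigenvalue $\lambda_2$ with $\lambda_1\ge|\lambda_2|$, and eigenvectors $\vec{\beta_1}$, $\vec{\beta_2}$ for $\lambda_1$, $\lambda_2$ respectively, with $B\vec{\beta_1}>0$ and $B\vec{\beta_2}>0$. Let $\vec{\alpha}\in\mathbb{R}^2$ satisfy $B\vec{\alpha}=0$ and $BA\vec{\alpha}>0$, and let $\vec{\alpha_{ -1}}=A^{ -1}\vec{\alpha}$. Then $\mathrm{NT}=\{k_1\vec{\alpha}+k_2\vec{\alpha_{ -1}} : k_1>0,\ k_2>0\}$.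
   Context: $\mathrm{NT}$ is the non-termination set of the loop $\mathrm{while}\ (B\vec{x}>0)\ \{\vec{x}:=A\vec{x}\}$. -}

module Defs where

open import Data.Nat using (ℕ; zero; suc)
open import Data.Product using (Σ; ∃; _×_; _,_)
open import Data.Sum using (_⊎_)
open import Relation.Binary.PropositionalEquality using (_≡_; _≢_)
open import Relation.Binary using (Tri)
open import Relation.Nullary using (¬_)

-- The real numbers, axiomatised as a complete ordered field
-- (any model is isomorphic to ℝ).  Equality is propositional.
record RealField : Set₁ where
  infixl 6 _+_
  infixl 7 _*_
  infix 4 _<_
  field
    Carrier : Set
    0# 1# : Carrier
    _+_ _*_ : Carrier → Carrier → Carrier
    -_ : Carrier → Carrier
    inv : (x : Carrier) → x ≢ 0# → Carrier
    _<_ : Carrier → Carrier → Set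
    +-assoc : ∀ x y z → (x + y) + z ≡ x + (y + z)
    +-comm : ∀ x y → x + y ≡ y + x
    +-identityˡ : ∀ x → 0# + x ≡ x
    -‿inverseˡ : ∀ x → (- x) + x ≡ 0#
    *-assoc : ∀ x y z → (x * y) * z ≡ x * (y * z)
    *-comm : ∀ x y → x * y ≡ y * x
    *-identityˡ : ∀ x → 1# * x ≡ x
    distribˡ : ∀ x y z → x * (y + z) ≡ x * y + x * z
    inv-inverseʳ : ∀ x (p : x ≢ 0#) → x * inv x p ≡ 1#
    0≢1 : 0# ≢ 1#
    <-irrefl : ∀ x → ¬ (x < x)
    <-trans : ∀ {x y z} → x < y → y < z → x < z
    <-cmp : ∀ x y → Tri (x < y) (x ≡ y) (y < x)
    +-monoˡ-< : ∀ {x y} z → x < y → x + z < y + z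
    *-pos : ∀ {x y} → 0# < x → 0# < y → 0# < x * y
    sup : (P : Carrier → Set) → ∃ P →
          (∃ λ u → ∀ x → P x → (x < u ⊎ x ≡ u)) →
          ∃ λ s → (∀ x → P x → (x < s ⊎ x ≡ s)) ×
                  (∀ u → (∀ x → P x → (x < u ⊎ x ≡ u)) → (s < u ⊎ s ≡ u))

module LinAlg (R : RealField) where
  open RealField R public

  infix 4 _≤_
  _≤_ : Carrier → Carrier → Set
  x ≤ y = x < y ⊎ x ≡ y

  Vec2 : Set
  Vec2 = Carrier × Carrier

  Row2 : Set
  Row2 = Carrier × Carrier

  -- 2×2 matrices ((a , b) , (c , d)) = [[a, b], [c, d]] (rows)
  Mat2 : Set
  Mat2 = (Carrier × Carrier) × (Carrier × Carrier)

  I₂ : Mat2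
  I₂ = ((1# , 0#) , (0# , 1#))

  _·_ : Mat2 → Mat2 → Mat2
  ((a , b) , (c , d)) · ((e , f) , (g , h)) =
    ((a * e + b * g , a * f + b * h) , (c * e + d * g , c * f + d * h))

  _⊙_ : Mat2 → Vec2 → Vec2
  ((a , b) , (c , d)) ⊙ (x , y) = (a * x + b * y , c * x + d * y)

  _⋆_ : Row2 → Vec2 → Carrier
  (p , q) ⋆ (x , y) = p * x + q * y

  _•_ : Carrier → Vec2 → Vec2
  k • (x , y) = (k * x , k * y)

  _⊕_ : Vec2 → Vec2 → Vec2
  (x , y) ⊕ (u , v) = (x + u , y + v)

  𝟎 : Vec2
  𝟎 = (0# , 0#)

  _^_ : Mat2 → ℕ → Mat2
  A ^ zero = I₂
  A ^ suc k = A · (A ^ k)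

  IsEigenpair : Mat2 → Carrier → Vec2 → Set
  IsEigenpair A λ′ β = β ≢ 𝟎 × A ⊙ β ≡ λ′ • β

  IsInverse : Mat2 → Mat2 → Set
  IsInverse A Ainv = A · Ainv ≡ I₂ × Ainv · A ≡ I₂

  -- non-termination set of  while (B x > 0) { x := A x }
  NT : Mat2 → Row2 → Vec2 → Set
  NT A B x = ∀ (k : ℕ) → 0# < B ⋆ ((A ^ k) ⊙ x)

module Submission where

-- Both eigenvalues are roots of the characteristic polynomial, so
-- (Vieta) tr A = λ₁ + λ₂ and det A = λ₁λ₂.  Cayley–Hamilton then turns the
-- guard values s_k = B Aᵏ x into a linear recurrence
--     s_{k+2} = (λ₁ + λ₂) s_{k+1} + c s_k,   c = -λ₁λ₂ > 0,
-- whose coefficients are nonnegative; hence s_k > 0 for all k exactly when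
-- s₀ > 0 and s₁ > 0, i.e. NT = {x : B x > 0, (BA) x > 0}.  Finally the rows
-- B and BA vanish on α resp. α₋₁ = A⁻¹α and are positive on the other
-- vector, so this open quadrant is the open cone spanned by α and α₋₁.

open import Defs
open import Level using (0ℓ)
open import Data.Nat using (zero; suc)
import Data.Nat as ℕ
open import Data.Product using (∃; _×_; _,_; proj₁; proj₂)
open import Data.Sum using (inj₁; inj₂)
open import Data.Maybe using (Maybe; just; nothing)
open import Data.Empty using (⊥-elim)
open import Function.Bundles using (_⇔_; mk⇔)
open import Function.Construct.Composition using (_⇔-∘_)
open import Relation.Nullary using (yes; no)
open import Relation.Binary using (tri<; tri≈; tri>)
open import Relation.Binary.PropositionalEquality
  using (_≡_; _≢_; refl; sym; trans; cong; cong₂; subst; subst₂; isEquivalence; module ≡-Reasoning)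
open import Algebra.Bundles using (CommutativeRing)

module Arithmetic (R : RealField) where
  open RealField R
  open LinAlg R using (_≤_)
  open ≡-Reasoning

  +-identityʳ : ∀ x → x + 0# ≡ x
  +-identityʳ x = trans (+-comm x 0#) (+-identityˡ x)

  -‿inverseʳ : ∀ x → x + (- x) ≡ 0#
  -‿inverseʳ x = trans (+-comm x (- x)) (-‿inverseˡ x)

  *-identityʳ : ∀ x → x * 1# ≡ x
  *-identityʳ x = trans (*-comm x 1#) (*-identityˡ x)

  distribʳ : ∀ x y z → (y + z) * x ≡ y * x + z * x
  distribʳ x y z = trans (*-comm (y + z) x)
    (trans (distribˡ x y z) (cong₂ _+_ (*-comm x y) (*-comm x z)))

  -- The field axioms of R packaged as a library commutative ring, so that
  -- derived laws and the ring solver become available.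
  commutativeRing : CommutativeRing 0ℓ 0ℓ
  commutativeRing = record
    { isCommutativeRing = record
      { isRing = record
        { +-isAbelianGroup = record
          { isGroup = record
            { isMonoid = record
              { isSemigroup = record
                { isMagma = record { isEquivalence = isEquivalence ; ∙-cong = cong₂ _+_ }
                ; assoc = +-assoc }
              ; identity = +-identityˡ , +-identityʳ }
            ; inverse = -‿inverseˡ , -‿inverseʳ
            ; ⁻¹-cong = cong -_ }
          ; comm = +-comm }
        ; *-cong = cong₂ _*_
        ; *-assoc = *-assoc
        ; *-identity = *-identityˡ , *-identityʳ
        ; distrib = distribˡ , distribʳ }
      ; *-comm = *-comm } }

  open CommutativeRing commutativeRing public using (zeroˡ; zeroʳ)
  open CommutativeRing commutativeRing using (commutativeSemiring; +-group)
  open import Algebra.Properties.Group +-group public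
    using () renaming (∙-cancelʳ to +-cancelʳ)
  open import Algebra.Properties.Semiring.Mult
    (CommutativeRing.semiring commutativeRing) using () renaming (_×_ to _×1_)

  -- Natural-number literals of R are compared through ℕ; this is all the
  -- semiring solver needs to normalise polynomial identities.
  compareLiterals : ∀ m n → Maybe (m ×1 1# ≡ n ×1 1#)
  compareLiterals m n with m ℕ.≟ n
  ... | yes refl = just refl
  ... | no _ = nothing

  open import Algebra.Solver.Ring.NaturalCoefficients commutativeSemiring compareLiterals public

  *-cancelʳ-nonzero : ∀ {x y z} → x ≢ 0# → y * x ≡ z * x → y ≡ z
  *-cancelʳ-nonzero {x} {y} {z} x≢0 eq = begin
    y                    ≡⟨ sym (*-identityʳ y) ⟩
    y * 1#               ≡⟨ cong (y *_) (sym (inv-inverseʳ x x≢0)) ⟩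
    y * (x * inv x x≢0)  ≡⟨ sym (*-assoc y x _) ⟩
    y * x * inv x x≢0    ≡⟨ cong (_* inv x x≢0) eq ⟩
    z * x * inv x x≢0    ≡⟨ *-assoc z x _ ⟩
    z * (x * inv x x≢0)  ≡⟨ cong (z *_) (inv-inverseʳ x x≢0) ⟩
    z * 1#               ≡⟨ *-identityʳ z ⟩
    z                    ∎

  div-mul : ∀ x y (y≢0 : y ≢ 0#) → x * inv y y≢0 * y ≡ x
  div-mul x y y≢0 = begin
    x * inv y y≢0 * y    ≡⟨ *-assoc x _ y ⟩
    x * (inv y y≢0 * y)  ≡⟨ cong (x *_) (*-comm _ y) ⟩
    x * (y * inv y y≢0)  ≡⟨ cong (x *_) (inv-inverseʳ y y≢0) ⟩
    x * 1#               ≡⟨ *-identityʳ x ⟩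
    x                    ∎

  -- Subtraction-free form of  (x - y)(p - q) = 0 ∧ x ≠ y ⇒ p = q.
  cross-cancel : ∀ {x y p q} → x * p + y * q ≡ y * p + x * q → x ≢ y → p ≡ q
  cross-cancel {x} {y} {p} {q} eq x≢y = *-cancelʳ-nonzero w≢0 (+-cancelʳ (y * p + y * q) _ _ (begin
    p * w + (y * p + y * q)  ≡⟨ regroup w y p q ⟩
    (w + y) * p + y * q      ≡⟨ cong (λ t → t * p + y * q) w+y≡x ⟩
    x * p + y * q            ≡⟨ eq ⟩
    y * p + x * q            ≡⟨ cong (λ t → y * p + t * q) (sym w+y≡x) ⟩
    y * p + (w + y) * q      ≡⟨ regroup′ w y p q ⟩
    q * w + (y * p + y * q)  ∎))
    where
    w = x + - y
    w+y≡x : w + y ≡ x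
    w+y≡x = trans (+-assoc x (- y) y) (trans (cong (x +_) (-‿inverseˡ y)) (+-identityʳ x))
    w≢0 : w ≢ 0#
    w≢0 w≡0 = x≢y (trans (sym w+y≡x) (trans (cong (_+ y) w≡0) (+-identityˡ y)))
    regroup : ∀ w y p q → p * w + (y * p + y * q) ≡ (w + y) * p + y * q
    regroup = solve 4 (λ w y p q → p :* w :+ (y :* p :+ y :* q) := (w :+ y) :* p :+ y :* q) refl
    regroup′ : ∀ w y p q → y * p + (w + y) * q ≡ q * w + (y * p + y * q)
    regroup′ = solve 4 (λ w y p q → y :* p :+ (w :+ y) :* q := q :* w :+ (y :* p :+ y :* q)) refl

  -- Subtraction-free form of  a - b = L - K = e - c  ⇒  a + e = b + c.
  balance : ∀ {a b c e K L} → a + K ≡ b + L → c + K ≡ e + L → a + e ≡ b + c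
  balance {a} {b} {c} {e} {K} {L} eq₁ eq₂ = +-cancelʳ (K + L) _ _ (begin
    a + e + (K + L)    ≡⟨ regroup a e K L ⟩
    (a + K) + (e + L)  ≡⟨ cong₂ _+_ eq₁ (sym eq₂) ⟩
    (b + L) + (c + K)  ≡⟨ regroup′ b L c K ⟩
    b + c + (K + L)    ∎)
    where
    regroup : ∀ a e K L → a + e + (K + L) ≡ (a + K) + (e + L)
    regroup = solve 4 (λ a e K L → a :+ e :+ (K :+ L) := (a :+ K) :+ (e :+ L)) refl
    regroup′ : ∀ b L c K → (b + L) + (c + K) ≡ b + c + (K + L)
    regroup′ = solve 4 (λ b L c K → (b :+ L) :+ (c :+ K) := b :+ c :+ (K :+ L)) refl

  pos⇒≢0 : ∀ {x} → 0# < x → x ≢ 0#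
  pos⇒≢0 0<x x≡0 = <-irrefl 0# (subst (0# <_) x≡0 0<x)

  nonneg+pos : ∀ {x y} → 0# ≤ x → 0# < y → 0# < x + y
  nonneg+pos {x} {y} (inj₂ 0≡x) 0<y = subst (0# <_) (cong (_+ y) 0≡x) (subst (0# <_) (sym (+-identityˡ y)) 0<y)
  nonneg+pos {x} {y} (inj₁ 0<x) 0<y = <-trans 0<x (subst (x <_) (+-comm y x) (subst (_< y + x) (+-identityˡ x) (+-monoˡ-< x 0<y)))

  neg⇒pos : ∀ {x} → x < 0# → 0# < - x
  neg⇒pos {x} x<0 = subst₂< (-‿inverseʳ x) (+-identityˡ (- x)) (+-monoˡ-< (- x) x<0)
    where
    subst₂< : ∀ {a b c d} → a ≡ c → b ≡ d → a < b → c < d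
    subst₂< refl refl a<b = a<b

  neg≤⇒nonneg-sum : ∀ {x y} → - y ≤ x → 0# ≤ x + y
  neg≤⇒nonneg-sum {x} {y} (inj₁ -y<x) = inj₁ (subst (_< x + y) (-‿inverseˡ y) (+-monoˡ-< y -y<x))
  neg≤⇒nonneg-sum {x} {y} (inj₂ -y≡x) = inj₂ (trans (sym (-‿inverseˡ y)) (cong (_+ y) -y≡x))

  nonneg*pos : ∀ {x y} → 0# ≤ x → 0# < y → 0# ≤ x * y
  nonneg*pos (inj₁ 0<x) 0<y = inj₁ (*-pos 0<x 0<y)
  nonneg*pos {x} {y} (inj₂ 0≡x) 0<y = inj₂ (sym (trans (cong (_* y) (sym 0≡x)) (zeroˡ y)))

  pos-factor : ∀ {c y} → 0# < c → 0# < c * y → 0# < y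
  pos-factor {c} {y} 0<c 0<cy with <-cmp y 0#
  ... | tri> _ _ 0<y = 0<y
  ... | tri≈ _ y≡0 _ = ⊥-elim (pos⇒≢0 0<cy (trans (cong (c *_) y≡0) (zeroʳ c)))
  ... | tri< y<0 _ _ = ⊥-elim (pos⇒≢0 (nonneg+pos (inj₁ 0<cy) (*-pos 0<c (neg⇒pos y<0))) cy+c[-y]≡0)
    where
    cy+c[-y]≡0 : c * y + c * (- y) ≡ 0#
    cy+c[-y]≡0 = trans (sym (distribˡ c y (- y))) (trans (cong (c *_) (-‿inverseʳ y)) (zeroʳ c))

  -- 1 > 0: 1 ≠ 0, and 1 < 0 would give 1 = (-1)(-1) > 0.
  0<1 : 0# < 1#
  0<1 with <-cmp 0# 1#
  ... | tri< 0<1 _ _ = 0<1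
  ... | tri≈ _ 0≡1 _ = ⊥-elim (0≢1 0≡1)
  ... | tri> _ _ 1<0 = ⊥-elim (<-irrefl 1# (<-trans 1<0 (subst (0# <_) [-1][-1]≡1 (*-pos 0<-1 0<-1))))
    where
    0<-1 = neg⇒pos 1<0
    [-1][-1]≡1 : - 1# * - 1# ≡ 1#
    [-1][-1]≡1 = +-cancelʳ (- 1#) _ _ (begin
      - 1# * - 1# + - 1#         ≡⟨ cong (- 1# * - 1# +_) (sym (*-identityʳ (- 1#))) ⟩
      - 1# * - 1# + - 1# * 1#    ≡⟨ sym (distribˡ (- 1#) (- 1#) 1#) ⟩
      - 1# * (- 1# + 1#)         ≡⟨ cong (- 1# *_) (-‿inverseˡ 1#) ⟩
      - 1# * 0#                  ≡⟨ zeroʳ (- 1#) ⟩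
      0#                         ≡⟨ sym (-‿inverseʳ 1#) ⟩
      1# + - 1#                  ∎)

  inv-pos : ∀ {y} (0<y : 0# < y) → 0# < inv y (pos⇒≢0 0<y)
  inv-pos {y} 0<y = pos-factor 0<y (subst (0# <_) (sym (inv-inverseʳ y (pos⇒≢0 0<y))) 0<1)

module Plane (R : RealField) where
  open LinAlg R public
  open Arithmetic R public
  open ≡-Reasoning

  ⊙-assoc : ∀ M N y → (M · N) ⊙ y ≡ M ⊙ (N ⊙ y)
  ⊙-assoc ((a , b) , (c , d)) ((e , f) , (g , h)) (y₁ , y₂) =
    cong₂ _,_ (rowAssoc a b e f g h y₁ y₂) (rowAssoc c d e f g h y₁ y₂)
    where
    rowAssoc : ∀ a b e f g h y₁ y₂ →
      (a * e + b * g) * y₁ + (a * f + b * h) * y₂ ≡ a * (e * y₁ + f * y₂) + b * (g * y₁ + h * y₂)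
    rowAssoc = solve 8 (λ a b e f g h y₁ y₂ →
      (a :* e :+ b :* g) :* y₁ :+ (a :* f :+ b :* h) :* y₂ := a :* (e :* y₁ :+ f :* y₂) :+ b :* (g :* y₁ :+ h :* y₂)) refl

  I₂-identity : ∀ y → I₂ ⊙ y ≡ y
  I₂-identity (y₁ , y₂) = cong₂ _,_ (first y₁ y₂) (second y₁ y₂)
    where
    first : ∀ y₁ y₂ → 1# * y₁ + 0# * y₂ ≡ y₁
    first = solve 2 (λ y₁ y₂ → con 1 :* y₁ :+ con 0 :* y₂ := y₁) refl
    second : ∀ y₁ y₂ → 0# * y₁ + 1# * y₂ ≡ y₂
    second = solve 2 (λ y₁ y₂ → con 0 :* y₁ :+ con 1 :* y₂ := y₂) refl

  inverse-cancels : ∀ {A Ainv} → A · Ainv ≡ I₂ → ∀ v → A ⊙ (Ainv ⊙ v) ≡ v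
  inverse-cancels {A} {Ainv} A·Ainv≡I v = begin
    A ⊙ (Ainv ⊙ v)  ≡⟨ sym (⊙-assoc A Ainv v) ⟩
    (A · Ainv) ⊙ v  ≡⟨ cong (_⊙ v) A·Ainv≡I ⟩
    I₂ ⊙ v          ≡⟨ I₂-identity v ⟩
    v               ∎

  ⊙-scale : ∀ A k v → A ⊙ (k • v) ≡ k • (A ⊙ v)
  ⊙-scale ((a , b) , (c , d)) k (v₁ , v₂) = cong₂ _,_ (pull a b k v₁ v₂) (pull c d k v₁ v₂)
    where
    pull : ∀ a b k v₁ v₂ → a * (k * v₁) + b * (k * v₂) ≡ k * (a * v₁ + b * v₂)
    pull = solve 5 (λ a b k v₁ v₂ → a :* (k :* v₁) :+ b :* (k :* v₂) := k :* (a :* v₁ :+ b :* v₂)) refl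

  ⋆-linear : ∀ B k u m v → B ⋆ ((k • u) ⊕ (m • v)) ≡ k * (B ⋆ u) + m * (B ⋆ v)
  ⋆-linear (p , q) k (u₁ , u₂) m (v₁ , v₂) = expand p q k m u₁ u₂ v₁ v₂
    where
    expand : ∀ p q k m u₁ u₂ v₁ v₂ →
      p * (k * u₁ + m * v₁) + q * (k * u₂ + m * v₂) ≡ k * (p * u₁ + q * u₂) + m * (p * v₁ + q * v₂)
    expand = solve 8 (λ p q k m u₁ u₂ v₁ v₂ →
      p :* (k :* u₁ :+ m :* v₁) :+ q :* (k :* u₂ :+ m :* v₂) := k :* (p :* u₁ :+ q :* u₂) :+ m :* (p :* v₁ :+ q :* v₂)) refl

  ⋆-scale : ∀ B k v → B ⋆ (k • v) ≡ k * (B ⋆ v)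
  ⋆-scale (p , q) k (v₁ , v₂) = solve 5 (λ p q k v₁ v₂ → p :* (k :* v₁) :+ q :* (k :* v₂) := k :* (p :* v₁ :+ q :* v₂)) refl p q k v₁ v₂

  infixl 7 _⋆ₘ_
  _⋆ₘ_ : Row2 → Mat2 → Row2
  (p , q) ⋆ₘ ((a , b) , (c , d)) = (p * a + q * c , p * b + q * d)

  ⋆-⊙ : ∀ B A y → B ⋆ (A ⊙ y) ≡ (B ⋆ₘ A) ⋆ y
  ⋆-⊙ (p , q) ((a , b) , (c , d)) (y₁ , y₂) = solve 8 (λ p q a b c d y₁ y₂ →
    p :* (a :* y₁ :+ b :* y₂) :+ q :* (c :* y₁ :+ d :* y₂) := (p :* a :+ q :* c) :* y₁ :+ (p :* b :+ q :* d) :* y₂) refl p q a b c d y₁ y₂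

  -- Trace and the two products whose difference is the determinant:
  -- det A = diag A - anti A.  Keeping them apart avoids subtraction.
  tr diag anti : Mat2 → Carrier
  tr ((a , b) , (c , d)) = a + d
  diag ((a , b) , (c , d)) = a * d
  anti ((a , b) , (c , d)) = b * c

  cayley-hamilton : ∀ B A y →
    B ⋆ (A ⊙ (A ⊙ y)) + diag A * (B ⋆ y) ≡ tr A * (B ⋆ (A ⊙ y)) + anti A * (B ⋆ y)
  cayley-hamilton (p , q) ((a , b) , (c , d)) (y₁ , y₂) = solve 8 (λ p q a b c d y₁ y₂ →
      p :* (a :* (a :* y₁ :+ b :* y₂) :+ b :* (c :* y₁ :+ d :* y₂))
        :+ q :* (c :* (a :* y₁ :+ b :* y₂) :+ d :* (c :* y₁ :+ d :* y₂))
        :+ (a :* d) :* (p :* y₁ :+ q :* y₂)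
    := (a :+ d) :* (p :* (a :* y₁ :+ b :* y₂) :+ q :* (c :* y₁ :+ d :* y₂))
        :+ (b :* c) :* (p :* y₁ :+ q :* y₂)) refl p q a b c d y₁ y₂

  IsCharRoot : Mat2 → Carrier → Set
  IsCharRoot A l = l * l + diag A ≡ tr A * l + anti A

  -- Every eigenvalue is a characteristic root; any row not vanishing on the
  -- eigenvector witnesses this.
  eigenvalue-root : ∀ {A l β} (B : Row2) → A ⊙ β ≡ l • β → B ⋆ β ≢ 0# → IsCharRoot A l
  eigenvalue-root {A} {l} {β} B Aβ≡lβ Bβ≢0 = *-cancelʳ-nonzero Bβ≢0 (begin
    (l * l + diag A) * s                ≡⟨ distribʳ s (l * l) (diag A) ⟩
    l * l * s + diag A * s              ≡⟨ cong (_+ diag A * s) (sym twoSteps) ⟩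
    B ⋆ (A ⊙ (A ⊙ β)) + diag A * s      ≡⟨ cayley-hamilton B A β ⟩
    tr A * (B ⋆ (A ⊙ β)) + anti A * s   ≡⟨ cong (λ t → tr A * t + anti A * s) oneStep ⟩
    tr A * (l * s) + anti A * s         ≡⟨ collect (tr A) l s (anti A) ⟩
    (tr A * l + anti A) * s             ∎)
    where
    s = B ⋆ β
    oneStep : B ⋆ (A ⊙ β) ≡ l * s
    oneStep = trans (cong (B ⋆_) Aβ≡lβ) (⋆-scale B l β)
    twoSteps : B ⋆ (A ⊙ (A ⊙ β)) ≡ l * l * s
    twoSteps = begin
      B ⋆ (A ⊙ (A ⊙ β))  ≡⟨ cong (λ v → B ⋆ (A ⊙ v)) Aβ≡lβ ⟩
      B ⋆ (A ⊙ (l • β))  ≡⟨ cong (B ⋆_) (⊙-scale A l β) ⟩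
      B ⋆ (l • (A ⊙ β))  ≡⟨ ⋆-scale B l (A ⊙ β) ⟩
      l * (B ⋆ (A ⊙ β))  ≡⟨ cong (l *_) oneStep ⟩
      l * (l * s)        ≡⟨ sym (*-assoc l l s) ⟩
      l * l * s          ∎
    collect : ∀ t l s e → t * (l * s) + e * s ≡ (t * l + e) * s
    collect = solve 4 (λ t l s e → t :* (l :* s) :+ e :* s := (t :* l :+ e) :* s) refl

  vieta : ∀ {T P Q l₁ l₂} → l₁ ≢ l₂ →
    l₁ * l₁ + P ≡ T * l₁ + Q → l₂ * l₂ + P ≡ T * l₂ + Q →
    l₁ + l₂ ≡ T × P ≡ l₁ * l₂ + Q
  vieta {T} {P} {Q} {l₁} {l₂} l₁≢l₂ root₁ root₂ = sum≡T , product
    where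
    sum≡T : l₁ + l₂ ≡ T
    sum≡T = cross-cancel (+-cancelʳ (l₂ * l₂ + P) _ _ (begin
      l₁ * (l₁ + l₂) + l₂ * T + (l₂ * l₂ + P)   ≡⟨ split₁ l₁ l₂ T P ⟩
      (l₁ * l₁ + P) + l₁ * l₂ + l₂ * T + l₂ * l₂ ≡⟨ cong (λ z → z + l₁ * l₂ + l₂ * T + l₂ * l₂) root₁ ⟩
      (T * l₁ + Q) + l₁ * l₂ + l₂ * T + l₂ * l₂ ≡⟨ split₂ l₁ l₂ T Q ⟩
      l₂ * (l₁ + l₂) + l₁ * T + (T * l₂ + Q)    ≡⟨ cong (l₂ * (l₁ + l₂) + l₁ * T +_) (sym root₂) ⟩
      l₂ * (l₁ + l₂) + l₁ * T + (l₂ * l₂ + P)   ∎)) l₁≢l₂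
      where
      split₁ : ∀ l₁ l₂ T P → l₁ * (l₁ + l₂) + l₂ * T + (l₂ * l₂ + P) ≡ (l₁ * l₁ + P) + l₁ * l₂ + l₂ * T + l₂ * l₂
      split₁ = solve 4 (λ l₁ l₂ T P → l₁ :* (l₁ :+ l₂) :+ l₂ :* T :+ (l₂ :* l₂ :+ P) := (l₁ :* l₁ :+ P) :+ l₁ :* l₂ :+ l₂ :* T :+ l₂ :* l₂) refl
      split₂ : ∀ l₁ l₂ T Q → (T * l₁ + Q) + l₁ * l₂ + l₂ * T + l₂ * l₂ ≡ l₂ * (l₁ + l₂) + l₁ * T + (T * l₂ + Q)
      split₂ = solve 4 (λ l₁ l₂ T Q → (T :* l₁ :+ Q) :+ l₁ :* l₂ :+ l₂ :* T :+ l₂ :* l₂ := l₂ :* (l₁ :+ l₂) :+ l₁ :* T :+ (T :* l₂ :+ Q)) refl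
    product : P ≡ l₁ * l₂ + Q
    product = +-cancelʳ (l₁ * l₁) _ _ (begin
      P + l₁ * l₁           ≡⟨ +-comm P (l₁ * l₁) ⟩
      l₁ * l₁ + P           ≡⟨ root₁ ⟩
      T * l₁ + Q            ≡⟨ cong (λ t → t * l₁ + Q) (sym sum≡T) ⟩
      (l₁ + l₂) * l₁ + Q    ≡⟨ expand l₁ l₂ Q ⟩
      l₁ * l₂ + Q + l₁ * l₁ ∎)
      where
      expand : ∀ l₁ l₂ Q → (l₁ + l₂) * l₁ + Q ≡ l₁ * l₂ + Q + l₁ * l₁
      expand = solve 3 (λ l₁ l₂ Q → (l₁ :+ l₂) :* l₁ :+ Q := l₁ :* l₂ :+ Q :+ l₁ :* l₁) refl

  Independent : Row2 → Row2 → Set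
  Independent (p , q) (r , s) = p * s ≢ q * r

  -- Independent rows separate points (Cramer's rule, coordinatewise).
  separate : ∀ {B C} → Independent B C → ∀ {y z} → B ⋆ y ≡ B ⋆ z → C ⋆ y ≡ C ⋆ z → y ≡ z
  separate {p , q} {r , s} indep {y₁ , y₂} {z₁ , z₂} By≡Bz Cy≡Cz = cong₂ _,_
    (cross-cancel (balance (cramer₁ y₁ y₂) (subst₂ (λ b c → (p * s) * z₁ + q * c ≡ (q * r) * z₁ + s * b)
                                              (sym By≡Bz) (sym Cy≡Cz) (cramer₁ z₁ z₂))) indep)
    (cross-cancel (balance (cramer₂ y₁ y₂) (subst₂ (λ b c → (p * s) * z₂ + r * b ≡ (q * r) * z₂ + p * c)
                                              (sym By≡Bz) (sym Cy≡Cz) (cramer₂ z₁ z₂))) indep)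
    where
    cramer₁ : ∀ y₁ y₂ → (p * s) * y₁ + q * (r * y₁ + s * y₂) ≡ (q * r) * y₁ + s * (p * y₁ + q * y₂)
    cramer₁ = solve 6 (λ p q r s y₁ y₂ → (p :* s) :* y₁ :+ q :* (r :* y₁ :+ s :* y₂)
                                     := (q :* r) :* y₁ :+ s :* (p :* y₁ :+ q :* y₂)) refl p q r s
    cramer₂ : ∀ y₁ y₂ → (p * s) * y₂ + r * (p * y₁ + q * y₂) ≡ (q * r) * y₂ + p * (r * y₁ + s * y₂)
    cramer₂ = solve 6 (λ p q r s y₁ y₂ → (p :* s) :* y₂ :+ r :* (p :* y₁ :+ q :* y₂)
                                     := (q :* r) :* y₂ :+ p :* (r :* y₁ :+ s :* y₂)) refl p q r s

  -- If B vanishes on α while B is positive on γ and C positive on α, then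
  -- B and C are independent (det [B;C] · det [α γ] = -(Bγ)(Cα) ≠ 0).
  independent : ∀ {B C α γ} → B ⋆ α ≡ 0# → 0# < B ⋆ γ → 0# < C ⋆ α → Independent B C
  independent {p , q} {r , s} {a₁ , a₂} {g₁ , g₂} Bα≡0 0<Bγ 0<Cα ps≡qr =
    pos⇒≢0 (*-pos 0<Bγ 0<Cα) (+-cancelʳ N _ _ (begin
      Bγ * Cα + N                                    ≡⟨ cong (λ t → Bγ * Cα + (t * (a₁ * g₂) + (q * r) * (a₂ * g₁))) (sym ps≡qr) ⟩
      Bγ * Cα + ((p * s) * (a₁ * g₂) + (q * r) * (a₂ * g₁)) ≡⟨ sym (cauchy-binet p q r s a₁ a₂ g₁ g₂) ⟩
      Bα * Cγ + ((p * s) * (a₂ * g₁) + (q * r) * (a₁ * g₂)) ≡⟨ cong₂ (λ t u → t * Cγ + (u * (a₂ * g₁) + (q * r) * (a₁ * g₂))) Bα≡0 ps≡qr ⟩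
      0# * Cγ + ((q * r) * (a₂ * g₁) + (q * r) * (a₁ * g₂)) ≡⟨ reorder Cγ ((q * r) * (a₁ * g₂)) ((q * r) * (a₂ * g₁)) ⟩
      0# + N                                         ∎))
    where
    Bα = p * a₁ + q * a₂
    Bγ = p * g₁ + q * g₂
    Cα = r * a₁ + s * a₂
    Cγ = r * g₁ + s * g₂
    N = (q * r) * (a₁ * g₂) + (q * r) * (a₂ * g₁)
    -- (Bα)(Cγ) - (Bγ)(Cα) = (ps - qr)(a₁g₂ - a₂g₁), without subtraction.
    cauchy-binet : ∀ p q r s a₁ a₂ g₁ g₂ →
      (p * a₁ + q * a₂) * (r * g₁ + s * g₂) + ((p * s) * (a₂ * g₁) + (q * r) * (a₁ * g₂))
      ≡ (p * g₁ + q * g₂) * (r * a₁ + s * a₂) + ((p * s) * (a₁ * g₂) + (q * r) * (a₂ * g₁))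
    cauchy-binet = solve 8 (λ p q r s a₁ a₂ g₁ g₂ →
      (p :* a₁ :+ q :* a₂) :* (r :* g₁ :+ s :* g₂) :+ ((p :* s) :* (a₂ :* g₁) :+ (q :* r) :* (a₁ :* g₂))
      := (p :* g₁ :+ q :* g₂) :* (r :* a₁ :+ s :* a₂) :+ ((p :* s) :* (a₁ :* g₂) :+ (q :* r) :* (a₂ :* g₁))) refl
    reorder : ∀ c u w → 0# * c + (w + u) ≡ 0# + (u + w)
    reorder = solve 3 (λ c u w → con 0 :* c :+ (w :+ u) := con 0 :+ (u :+ w)) refl

  positive-cone : ∀ {B C α γ} → B ⋆ α ≡ 0# → C ⋆ γ ≡ 0# → 0# < B ⋆ γ → 0# < C ⋆ α → ∀ x →
    (0# < B ⋆ x × 0# < C ⋆ x) ⇔ (∃ λ k₁ → ∃ λ k₂ → 0# < k₁ × 0# < k₂ × x ≡ (k₁ • α) ⊕ (k₂ • γ))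
  positive-cone {B} {C} {α} {γ} Bα≡0 Cγ≡0 0<Bγ 0<Cα x = mk⇔ coordinates guards
    where
    B-on-span : ∀ k₁ k₂ → B ⋆ ((k₁ • α) ⊕ (k₂ • γ)) ≡ k₂ * (B ⋆ γ)
    B-on-span k₁ k₂ = begin
      B ⋆ ((k₁ • α) ⊕ (k₂ • γ))         ≡⟨ ⋆-linear B k₁ α k₂ γ ⟩
      k₁ * (B ⋆ α) + k₂ * (B ⋆ γ)       ≡⟨ cong (λ t → k₁ * t + k₂ * (B ⋆ γ)) Bα≡0 ⟩
      k₁ * 0# + k₂ * (B ⋆ γ)            ≡⟨ cong (_+ k₂ * (B ⋆ γ)) (zeroʳ k₁) ⟩
      0# + k₂ * (B ⋆ γ)                 ≡⟨ +-identityˡ _ ⟩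
      k₂ * (B ⋆ γ)                      ∎
    C-on-span : ∀ k₁ k₂ → C ⋆ ((k₁ • α) ⊕ (k₂ • γ)) ≡ k₁ * (C ⋆ α)
    C-on-span k₁ k₂ = begin
      C ⋆ ((k₁ • α) ⊕ (k₂ • γ))         ≡⟨ ⋆-linear C k₁ α k₂ γ ⟩
      k₁ * (C ⋆ α) + k₂ * (C ⋆ γ)       ≡⟨ cong (λ t → k₁ * (C ⋆ α) + k₂ * t) Cγ≡0 ⟩
      k₁ * (C ⋆ α) + k₂ * 0#            ≡⟨ cong (k₁ * (C ⋆ α) +_) (zeroʳ k₂) ⟩
      k₁ * (C ⋆ α) + 0#                 ≡⟨ +-identityʳ _ ⟩
      k₁ * (C ⋆ α)                      ∎
    coordinates : 0# < B ⋆ x × 0# < C ⋆ x →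
      ∃ λ k₁ → ∃ λ k₂ → 0# < k₁ × 0# < k₂ × x ≡ (k₁ • α) ⊕ (k₂ • γ)
    coordinates (0<Bx , 0<Cx) =
      k₁ , k₂ , *-pos 0<Cx (inv-pos 0<Cα) , *-pos 0<Bx (inv-pos 0<Bγ) ,
      separate (independent Bα≡0 0<Bγ 0<Cα)
        (sym (trans (B-on-span k₁ k₂) (div-mul (B ⋆ x) (B ⋆ γ) _)))
        (sym (trans (C-on-span k₁ k₂) (div-mul (C ⋆ x) (C ⋆ α) _)))
      where
      k₁ = (C ⋆ x) * inv (C ⋆ α) (pos⇒≢0 0<Cα)
      k₂ = (B ⋆ x) * inv (B ⋆ γ) (pos⇒≢0 0<Bγ)
    guards : (∃ λ k₁ → ∃ λ k₂ → 0# < k₁ × 0# < k₂ × x ≡ (k₁ • α) ⊕ (k₂ • γ)) →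
      0# < B ⋆ x × 0# < C ⋆ x
    guards (k₁ , k₂ , 0<k₁ , 0<k₂ , x≡) =
      subst (0# <_) (sym (trans (cong (B ⋆_) x≡) (B-on-span k₁ k₂))) (*-pos 0<k₂ 0<Bγ) ,
      subst (0# <_) (sym (trans (cong (C ⋆_) x≡) (C-on-span k₁ k₂))) (*-pos 0<k₁ 0<Cα)

module Guard (R : RealField) where
  open Plane R public
  open ≡-Reasoning

  GuardRecurrence : Mat2 → Row2 → Carrier → Carrier → Set
  GuardRecurrence A B S c = ∀ y → B ⋆ (A ⊙ (A ⊙ y)) ≡ S * (B ⋆ (A ⊙ y)) + c * (B ⋆ y)

  -- With distinct characteristic roots l₁, l₂, Cayley–Hamilton and Vieta
  -- give the recurrence with S = l₁ + l₂ and c = -l₁l₂.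
  guard-recurrence : ∀ {A l₁ l₂} → l₁ ≢ l₂ → IsCharRoot A l₁ → IsCharRoot A l₂ →
    ∀ B → GuardRecurrence A B (l₁ + l₂) ((- l₂) * l₁)
  guard-recurrence {A} {l₁} {l₂} l₁≢l₂ root₁ root₂ B y = +-cancelʳ ((l₁ * l₂ + anti A) * s₀) _ _ (begin
    s₂ + (l₁ * l₂ + anti A) * s₀                     ≡⟨ cong (λ t → s₂ + t * s₀) (sym diag≡) ⟩
    s₂ + diag A * s₀                                 ≡⟨ cayley-hamilton B A y ⟩
    tr A * s₁ + anti A * s₀                          ≡⟨ cong (λ t → t * s₁ + anti A * s₀) (sym sum≡tr) ⟩
    (l₁ + l₂) * s₁ + anti A * s₀                     ≡⟨ sym (+-identityʳ _) ⟩
    (l₁ + l₂) * s₁ + anti A * s₀ + 0#                ≡⟨ cong ((l₁ + l₂) * s₁ + anti A * s₀ +_) (sym vanish) ⟩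
    (l₁ + l₂) * s₁ + anti A * s₀ + (- l₂ + l₂) * (l₁ * s₀) ≡⟨ regroup l₁ l₂ (- l₂) (anti A) s₀ s₁ ⟩
    ((l₁ + l₂) * s₁ + ((- l₂) * l₁) * s₀) + (l₁ * l₂ + anti A) * s₀ ∎)
    where
    s₀ = B ⋆ y
    s₁ = B ⋆ (A ⊙ y)
    s₂ = B ⋆ (A ⊙ (A ⊙ y))
    sum≡tr : l₁ + l₂ ≡ tr A
    sum≡tr = proj₁ (vieta l₁≢l₂ root₁ root₂)
    diag≡ : diag A ≡ l₁ * l₂ + anti A
    diag≡ = proj₂ (vieta l₁≢l₂ root₁ root₂)
    vanish : (- l₂ + l₂) * (l₁ * s₀) ≡ 0#
    vanish = trans (cong (_* (l₁ * s₀)) (-‿inverseˡ l₂)) (zeroˡ _)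
    regroup : ∀ l₁ l₂ μ Q s₀ s₁ → (l₁ + l₂) * s₁ + Q * s₀ + (μ + l₂) * (l₁ * s₀)
                                   ≡ ((l₁ + l₂) * s₁ + (μ * l₁) * s₀) + (l₁ * l₂ + Q) * s₀
    regroup = solve 6 (λ l₁ l₂ μ Q s₀ s₁ → (l₁ :+ l₂) :* s₁ :+ Q :* s₀ :+ (μ :+ l₂) :* (l₁ :* s₀)
                                        := ((l₁ :+ l₂) :* s₁ :+ (μ :* l₁) :* s₀) :+ (l₁ :* l₂ :+ Q) :* s₀) refl

  guard-at-preimage : ∀ {A B S c α γ} → GuardRecurrence A B S c →
    A ⊙ γ ≡ α → B ⋆ α ≡ 0# → B ⋆ (A ⊙ α) ≡ c * (B ⋆ γ)
  guard-at-preimage {A} {B} {S} {c} {α} {γ} recurrence Aγ≡α Bα≡0 = begin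
    B ⋆ (A ⊙ α)                       ≡⟨ cong (λ v → B ⋆ (A ⊙ v)) (sym Aγ≡α) ⟩
    B ⋆ (A ⊙ (A ⊙ γ))                 ≡⟨ recurrence γ ⟩
    S * (B ⋆ (A ⊙ γ)) + c * (B ⋆ γ)   ≡⟨ cong (λ v → S * (B ⋆ v) + c * (B ⋆ γ)) Aγ≡α ⟩
    S * (B ⋆ α) + c * (B ⋆ γ)         ≡⟨ cong (λ t → S * t + c * (B ⋆ γ)) Bα≡0 ⟩
    S * 0# + c * (B ⋆ γ)              ≡⟨ cong (_+ c * (B ⋆ γ)) (zeroʳ S) ⟩
    0# + c * (B ⋆ γ)                  ≡⟨ +-identityˡ _ ⟩
    c * (B ⋆ γ)                       ∎

  -- A recurrence with S ≥ 0 and c > 0 keeps consecutive guard values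
  -- positive, so the loop runs forever iff its first two guards hold.
  NT⇔positive-start : ∀ {A B S c} → 0# ≤ S → 0# < c → GuardRecurrence A B S c →
    ∀ x → NT A B x ⇔ (0# < B ⋆ x × 0# < (B ⋆ₘ A) ⋆ x)
  NT⇔positive-start {A} {B} {S} {c} 0≤S 0<c recurrence x = mk⇔ firstTwo forever
    where
    positive-pairs : ∀ k → 0# < B ⋆ x → 0# < B ⋆ (A ⊙ x) →
      0# < B ⋆ ((A ^ k) ⊙ x) × 0# < B ⋆ (A ⊙ ((A ^ k) ⊙ x))
    positive-pairs zero 0<s₀ 0<s₁ =
      subst (λ v → 0# < B ⋆ v) (sym (I₂-identity x)) 0<s₀ ,
      subst (λ v → 0# < B ⋆ (A ⊙ v)) (sym (I₂-identity x)) 0<s₁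
    positive-pairs (suc k) 0<s₀ 0<s₁ with positive-pairs k 0<s₀ 0<s₁
    ... | 0<sₖ , 0<sₖ₊₁ =
      subst (λ v → 0# < B ⋆ v) (sym (⊙-assoc A (A ^ k) x)) 0<sₖ₊₁ ,
      subst (λ v → 0# < B ⋆ (A ⊙ v)) (sym (⊙-assoc A (A ^ k) x))
        (subst (0# <_) (sym (recurrence ((A ^ k) ⊙ x)))
          (nonneg+pos (nonneg*pos 0≤S 0<sₖ₊₁) (*-pos 0<c 0<sₖ)))
    firstTwo : NT A B x → 0# < B ⋆ x × 0# < (B ⋆ₘ A) ⋆ x
    firstTwo nt =
      subst (λ v → 0# < B ⋆ v) (I₂-identity x) (nt 0) ,
      subst (0# <_) (trans (cong (B ⋆_) (trans (⊙-assoc A I₂ x) (cong (A ⊙_) (I₂-identity x)))) (⋆-⊙ B A x)) (nt 1)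
    forever : 0# < B ⋆ x × 0# < (B ⋆ₘ A) ⋆ x → NT A B x
    forever (0<s₀ , 0<Cx) k = proj₁ (positive-pairs k 0<s₀ (subst (0# <_) (sym (⋆-⊙ B A x)) 0<Cx))

-- With γ = α₋₁ = A⁻¹α, the rows B and BA are dual to α and γ:
-- B α = 0, (BA) γ = B α = 0, (BA) α > 0, and B γ > 0 by the recurrence.
lemma9 : (R : RealField) → let open LinAlg R in
    (A : Mat2) (B : Row2) (λ₁ λ₂ : Carrier) (β₁ β₂ : Vec2) →
    0# < λ₁ → λ₂ < 0# → (- λ₂) ≤ λ₁ →
    IsEigenpair A λ₁ β₁ → IsEigenpair A λ₂ β₂ →
    0# < B ⋆ β₁ → 0# < B ⋆ β₂ →
    (α : Vec2) → B ⋆ α ≡ 0# → 0# < B ⋆ (A ⊙ α) →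
    (Ainv : Mat2) → IsInverse A Ainv →
    ∀ (x : Vec2) → NT A B x ⇔
    (∃ λ k₁ → ∃ λ k₂ → 0# < k₁ × 0# < k₂ × x ≡ (k₁ • α) ⊕ (k₂ • (Ainv ⊙ α)))
lemma9 R A B λ₁ λ₂ β₁ β₂ 0<λ₁ λ₂<0 -λ₂≤λ₁ (_ , Aβ₁) (_ , Aβ₂) 0<Bβ₁ 0<Bβ₂
       α Bα≡0 0<BAα Ainv (A·Ainv≡I , _) x =
  positive-cone Bα≡0 Cγ≡0 0<Bγ 0<Cα x ⇔-∘ NT⇔positive-start 0≤S 0<c recurrence x
  where
  open Guard R
  λ₁≢λ₂ : λ₁ ≢ λ₂
  λ₁≢λ₂ λ₁≡λ₂ = <-irrefl 0# (<-trans 0<λ₁ (subst (_< 0#) (sym λ₁≡λ₂) λ₂<0))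
  recurrence : GuardRecurrence A B (λ₁ + λ₂) ((- λ₂) * λ₁)
  recurrence = guard-recurrence λ₁≢λ₂ (eigenvalue-root B Aβ₁ (pos⇒≢0 0<Bβ₁))
                                      (eigenvalue-root B Aβ₂ (pos⇒≢0 0<Bβ₂)) B
  0≤S : 0# ≤ λ₁ + λ₂
  0≤S = neg≤⇒nonneg-sum -λ₂≤λ₁
  0<c : 0# < (- λ₂) * λ₁
  0<c = *-pos (neg⇒pos λ₂<0) 0<λ₁
  γ : Vec2
  γ = Ainv ⊙ α
  Aγ≡α : A ⊙ γ ≡ α
  Aγ≡α = inverse-cancels A·Ainv≡I α
  Cγ≡0 : (B ⋆ₘ A) ⋆ γ ≡ 0#
  Cγ≡0 = trans (sym (⋆-⊙ B A γ)) (trans (cong (B ⋆_) Aγ≡α) Bα≡0)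
  0<Cα : 0# < (B ⋆ₘ A) ⋆ α
  0<Cα = subst (0# <_) (⋆-⊙ B A α) 0<BAα
  0<Bγ : 0# < B ⋆ γ
  0<Bγ = pos-factor 0<c (subst (0# <_) (guard-at-preimage recurrence Aγ≡α Bα≡0) 0<BAα)
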